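{- Let $s\ge3$ be an integer. Then for every integer $n\ge0$, $\beta_{n+2^{s+1}}\equiv\beta_n\pmod{2^s}$.
   Context: $t_n$ is the number of involutions of $[n]$ (permutations with $\pi^2=1$), $t_0=1$; ${\rm ord}_2(m)$ is the largest $e$ with $2^e\mid m$; $\beta_n=t_n/2^{{\rm ord}_2(t_n)}$ is the odd part of $t_n$. -}

module Defs where

open import Data.Nat using (ℕ; zero; suc; _+_; _*_; _/_; _%_)

-- Number of involutions of [n]: t 0 = 1, t 1 = 1, t (n+2) = t (n+1) + (n+1) * t n
-- (standard recurrence: n+2 is either a fixed point or swapped with one of the other n+1 points).
t : ℕ → ℕ
t zero = 1
t (suc zero) = 1
t (suc (suc n)) = t (suc n) + suc n * t n

oddPartAux : ℕ → ℕ → ℕ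
oddPartAux zero m = m
oddPartAux (suc f) zero = zero
oddPartAux (suc f) (suc m) with suc m % 2
... | zero = oddPartAux f (suc m / 2)
... | suc _ = suc m

-- m / 2^{ord_2 m} (fuel m suffices since each halving decreases m)
oddPart : ℕ → ℕ
oddPart m = oddPartAux m m

β : ℕ → ℕ
β n = oddPart (t n)

-- Split n by its residue mod 4: t(4k) = 2^k A k, t(4k+1) = 2^k B k,
-- t(4k+2) = 2^(k+1) C k and t(4k+3) = 2^(k+2) D k with A, B, C, D odd, where (C, D) obeys a
-- two-term recurrence with polynomial coefficients; so β runs through these four odd sequences.
-- Fix K ≥ 1 and v = A K. Shifting a polynomial coefficient by K changes it by a multiple of 2K
-- whose parity is known, and induction on k gives V (k + K) ≡ v V k + 2K (c + k) (mod 4K) for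
-- each of the four sequences V (c = 1 for C, 0 otherwise). Modulo 2K this reads
-- V (k + K) ≡ v V k; at k = K with K even it gives A (2K) ≡ (A K)² (mod 4K), whence
-- A (2^r) ≡ 1 (mod 2^(r+1)) for r ≥ 2 starting from A 4 ≡ 1 (mod 8). With K = 2^(s-1) every
-- block then satisfies V (k + K) ≡ V k (mod 2^s), i.e. β (n + 2^(s+1)) ≡ β n (mod 2^s).

module Submission where

open import Defs
open import Data.Product using (∃-syntax; _×_; _,_; proj₁; proj₂)
open import Function.Base using (_∘_)
open import Relation.Binary.PropositionalEquality

module OddPart where
  open import Data.Nat using (ℕ; zero; suc; _+_; _*_; _^_; _≤_; _<_; z<s; s≤s; NonZero)
  open import Data.Nat.Properties
    using (+-mono-≤; +-identityʳ; *-identityˡ; ≤-trans; <⇒≤; m≤m*n; m*n≢0; m^n≢0; m^n>0)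
  open import Data.Nat.DivMod using (_%_; _/_; m*n%n≡0; m*n/n≡m; [m+kn]%n≡m%n)
  open import Data.Nat.Tactic.RingSolver using (solve-∀)
  open ≡-Reasoning

  Odd : ℕ → Set
  Odd n = ∃[ m ] n ≡ 1 + m * 2

  n<2^n : ∀ n → n < 2 ^ n
  n<2^n zero = z<s
  n<2^n (suc n) = +-mono-≤ (m^n>0 2 n) (subst (suc n ≤_) (sym (+-identityʳ (2 ^ n))) (n<2^n n))

  oddPartAux-odd : ∀ f {n} → n % 2 ≡ 1 → oddPartAux (suc f) n ≡ n
  oddPartAux-odd f {suc n} n%2≡1 with suc n % 2 | n%2≡1
  ... | suc _ | _ = refl

  oddPartAux-*2 : ∀ f n .{{_ : NonZero n}} → oddPartAux (suc f) (n * 2) ≡ oddPartAux f n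
  oddPartAux-*2 f n@(suc _) with n * 2 % 2 | m*n%n≡0 n 2
  ... | zero | _ = cong (oddPartAux f) (m*n/n≡m n 2)

  oddPartAux-2^*odd : ∀ {f} e {u} → e ≤ f → Odd u → oddPartAux f (2 ^ e * u) ≡ u
  oddPartAux-2^*odd {zero} zero {u} _ _ = *-identityˡ u
  oddPartAux-2^*odd {suc f} zero {u} _ (m , refl) =
    trans (cong (oddPartAux (suc f)) (*-identityˡ u)) (oddPartAux-odd f ([m+kn]%n≡m%n 1 m 2))
  oddPartAux-2^*odd {suc f} (suc e) {u} (s≤s e≤f) odd-u@(m , refl) = begin
    oddPartAux (suc f) (2 ^ suc e * u) ≡⟨ cong (oddPartAux (suc f)) (double-assoc (2 ^ e) u) ⟩
    oddPartAux (suc f) (2 ^ e * u * 2) ≡⟨ oddPartAux-*2 f (2 ^ e * u) {{m*n≢0 (2 ^ e) u {{m^n≢0 2 e}}}} ⟩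
    oddPartAux f (2 ^ e * u)           ≡⟨ oddPartAux-2^*odd e e≤f odd-u ⟩
    u                                  ∎
    where
    double-assoc : ∀ x y → 2 * x * y ≡ x * y * 2
    double-assoc = solve-∀

  β≡odd-factor : ∀ {n} e {u} → t n ≡ 2 ^ e * u → Odd u → β n ≡ u
  β≡odd-factor {n} e {u} t≡ odd-u@(m , refl) = begin
    oddPartAux (t n) (t n)               ≡⟨ cong (λ x → oddPartAux x x) t≡ ⟩
    oddPartAux (2 ^ e * u) (2 ^ e * u) ≡⟨ oddPartAux-2^*odd e e≤2^e*u odd-u ⟩
    u                                    ∎
    where
    e≤2^e*u : e ≤ 2 ^ e * u
    e≤2^e*u = ≤-trans (<⇒≤ (n<2^n e)) (m≤m*n (2 ^ e) u)

module Blocks where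
  open import Data.Nat using (ℕ; zero; suc; _+_; _*_; _^_)
  open import Data.Nat.Tactic.RingSolver using (solve-∀; solve)
  open import Data.List.Base using (_∷_; [])
  open OddPart

  -- Substituting the factorisation below into t (m + 2) = t (m + 1) + (m + 1) * t m four times
  -- produces these recurrences.
  C D : ℕ → ℕ
  C zero = 1
  C (suc k) = (4 * k + 3) * (2 * k + 3) * C k + (8 * k + 10) * D k
  D zero = 1
  D (suc k) = (4 * k + 3) * (2 * k + 3) * C k + (4 * k + 5) * (2 * k + 4) * D k

  A B : ℕ → ℕ
  A zero = 1
  A (suc k) = 2 * D k + (4 * k + 3) * C k
  B zero = 1
  B (suc k) = (4 * k + 3) * C k + (8 * k + 10) * D k

  record Factorisation (k : ℕ) : Set where
    field
      t[4k]   : t (k * 4) ≡ 2 ^ k * A k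
      t[4k+1] : t (1 + k * 4) ≡ 2 ^ k * B k
      t[4k+2] : t (2 + k * 4) ≡ 2 ^ (1 + k) * C k
      t[4k+3] : t (3 + k * 4) ≡ 2 ^ (2 + k) * D k

  t-factorisation : ∀ k → Factorisation k
  t-factorisation zero = record { t[4k] = refl ; t[4k+1] = refl ; t[4k+2] = refl ; t[4k+3] = refl }
  t-factorisation (suc k) = record
    { t[4k] = t[4k+4] ; t[4k+1] = t[4k+5] ; t[4k+2] = t[4k+6] ; t[4k+3] = t[4k+7] }
    where
    open Factorisation (t-factorisation k)
    t[4k+4] : t (4 + k * 4) ≡ 2 ^ suc k * A (suc k)
    t[4k+4] rewrite t[4k+3] | t[4k+2] = identity (2 ^ k) (C k) (D k) k
      where
      identity : ∀ p c d k → 2 * (2 * p) * d + (3 + k * 4) * (2 * p * c)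
                           ≡ 2 * p * (2 * d + (4 * k + 3) * c)
      identity = solve-∀
    t[4k+5] : t (5 + k * 4) ≡ 2 ^ suc k * B (suc k)
    t[4k+5] rewrite t[4k+4] | t[4k+3] = identity (2 ^ k) (C k) (D k) k
      where
      identity : ∀ p c d k → 2 * p * (2 * d + (4 * k + 3) * c) + (4 + k * 4) * (2 * (2 * p) * d)
                           ≡ 2 * p * ((4 * k + 3) * c + (8 * k + 10) * d)
      identity = solve-∀
    t[4k+6] : t (6 + k * 4) ≡ 2 ^ (2 + k) * C (suc k)
    t[4k+6] rewrite t[4k+5] | t[4k+4] = identity (2 ^ k) (C k) (D k) k
      where
      identity : ∀ p c d k → 2 * p * ((4 * k + 3) * c + (8 * k + 10) * d)
                               + (5 + k * 4) * (2 * p * (2 * d + (4 * k + 3) * c))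
                           ≡ 2 * (2 * p) * ((4 * k + 3) * (2 * k + 3) * c + (8 * k + 10) * d)
      identity = solve-∀
    t[4k+7] : t (7 + k * 4) ≡ 2 ^ (3 + k) * D (suc k)
    t[4k+7] rewrite t[4k+6] | t[4k+5] = identity (2 ^ k) (C k) (D k) k
      where
      identity : ∀ p c d k → 2 * (2 * p) * ((4 * k + 3) * (2 * k + 3) * c + (8 * k + 10) * d)
                               + (6 + k * 4) * (2 * p * ((4 * k + 3) * c + (8 * k + 10) * d))
                           ≡ 2 * (2 * (2 * p)) * ((4 * k + 3) * (2 * k + 3) * c + (4 * k + 5) * (2 * k + 4) * d)
      identity = solve-∀

  C-step-odd : ∀ k {c d} → Odd c → Odd d → Odd ((4 * k + 3) * (2 * k + 3) * c + (8 * k + 10) * d)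
  C-step-odd k (c , refl) (d , refl) =
    4 * k * k + 13 * k + 9 + (4 * k + 3) * (2 * k + 3) * c + (8 * k + 10) * d
    , solve (k ∷ c ∷ d ∷ [])

  D-step-odd : ∀ k {c d} → Odd c → Odd d →
    Odd ((4 * k + 3) * (2 * k + 3) * c + (4 * k + 5) * (2 * k + 4) * d)
  D-step-odd k (c , refl) (d , refl) =
    8 * k * k + 22 * k + 14 + (4 * k + 3) * (2 * k + 3) * c + (4 * k + 5) * (2 * k + 4) * d
    , solve (k ∷ c ∷ d ∷ [])

  C-D-odd : ∀ k → Odd (C k) × Odd (D k)
  C-D-odd zero = (0 , refl) , (0 , refl)
  C-D-odd (suc k) = C-step-odd k odd-c odd-d , D-step-odd k odd-c odd-d
    where
    odd-c = proj₁ (C-D-odd k)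
    odd-d = proj₂ (C-D-odd k)

  A-odd : ∀ k → Odd (A k)
  A-odd zero = 0 , refl
  A-odd (suc k) = step (proj₁ (C-D-odd k)) (proj₂ (C-D-odd k))
    where
    step : ∀ {c d} → Odd c → Odd d → Odd (2 * d + (4 * k + 3) * c)
    step (c , refl) (d , refl) = 2 * k + 2 + 2 * d + (4 * k + 3) * c , solve (k ∷ c ∷ d ∷ [])

  B-odd : ∀ k → Odd (B k)
  B-odd zero = 0 , refl
  B-odd (suc k) = step (proj₁ (C-D-odd k)) (proj₂ (C-D-odd k))
    where
    step : ∀ {c d} → Odd c → Odd d → Odd ((4 * k + 3) * c + (8 * k + 10) * d)
    step (c , refl) (d , refl) = 6 * k + 6 + (4 * k + 3) * c + (8 * k + 10) * d , solve (k ∷ c ∷ d ∷ [])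

module Congruence where
  open import Data.Integer using (ℤ; +_; _+_; _*_; _-_)
  open import Data.Integer.Properties using (pos-*)
  open import Data.Integer.Tactic.RingSolver using (solve)
  open import Data.List.Base using (_∷_; [])
  open import Data.Integer.Divisibility using (_∣_)
  import Data.Integer.Divisibility.Signed as Signed
  open OddPart using (Odd)

  -- A record rather than a Σ-type, so that unification can read x, y and m off the type
  -- instead of facing the reducing term y + q * m.
  infix 4 _≡_mod_
  record _≡_mod_ (x y m : ℤ) : Set where
    constructor witness
    field
      quotient : ℤ
      equation : x ≡ y + quotient * m

  ≡mod-resp : ∀ {x x′ y y′ m} → x ≡ x′ → y ≡ y′ → x ≡ y mod m → x′ ≡ y′ mod m
  ≡mod-resp refl refl x≡y = x≡y

  ≡mod-trans : ∀ {x y z m} → x ≡ y mod m → y ≡ z mod m → x ≡ z mod m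
  ≡mod-trans {z = z} {m = m} (witness q refl) (witness r refl) = witness (r + q) (solve (z ∷ m ∷ q ∷ r ∷ []))

  ≡mod-*ʳ : ∀ {x y m} z → x ≡ y mod m → x * z ≡ y * z mod m
  ≡mod-*ʳ {y = y} {m = m} z (witness q refl) = witness (q * z) (solve (y ∷ m ∷ q ∷ z ∷ []))

  ≡mod⇒∣ : ∀ {x y m} → x ≡ y mod m → m ∣ x - y
  ≡mod⇒∣ {y = y} {m = m} (witness q refl) = Signed.∣⇒∣ᵤ (Signed.divides q difference)
    where
    difference : y + q * m - y ≡ q * m
    difference = solve (y ∷ m ∷ q ∷ [])

  ≡mod-weaken : ∀ {x y κ} d → x ≡ y + + 2 * κ * d mod + 4 * κ → x ≡ y mod + 2 * κ
  ≡mod-weaken {y = y} {κ = κ} d (witness q refl) = witness (q * + 2 + d) (solve (y ∷ κ ∷ d ∷ q ∷ []))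

  ≡mod-absorb-even : ∀ {x y κ} η → x ≡ y + + 2 * κ * (+ 2 * η) mod + 4 * κ → x ≡ y mod + 4 * κ
  ≡mod-absorb-even {y = y} {κ = κ} η (witness q refl) = witness (q + η) (solve (y ∷ κ ∷ η ∷ q ∷ []))

  square-≡1 : ∀ {x κ} → x ≡ + 1 mod + 2 * κ → x * x ≡ + 1 mod + 4 * κ
  square-≡1 {κ = κ} (witness q refl) = witness (q + κ * q * q) (solve (κ ∷ q ∷ []))

  Oddℤ : ℤ → Set
  Oddℤ x = ∃[ w ] x ≡ + 1 + w * + 2

  +-odd : ∀ {n} → Odd n → Oddℤ (+ n)
  +-odd (m , refl) = + m , cong (_+_ (+ 1)) (pos-* m 2)

module Recurrence where
  open import Data.Nat as ℕ using (ℕ)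
  open import Data.Integer using (+_; _+_; _*_)
  open import Data.Integer.Properties using (pos-*)
  open import Data.Integer.Tactic.RingSolver using (solve)
  open import Data.List.Base using (_∷_; [])
  open Blocks
  open Congruence

  pos-affine : ∀ a b n → + (a ℕ.* n ℕ.+ b) ≡ + a * + n + + b
  pos-affine a b n = cong (_+ + b) (pos-* a n)

  pos-affine² : ∀ a b c d n → + ((a ℕ.* n ℕ.+ b) ℕ.* (c ℕ.* n ℕ.+ d)) ≡ (+ a * + n + + b) * (+ c * + n + + d)
  pos-affine² a b c d n = trans (pos-* (a ℕ.* n ℕ.+ b) (c ℕ.* n ℕ.+ d)) (cong₂ _*_ (pos-affine a b n) (pos-affine c d n))

  pos-lincomb : ∀ {p q r s} x y → + p ≡ r → + q ≡ s → + (p ℕ.* x ℕ.+ q ℕ.* y) ≡ r * + x + s * + y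
  pos-lincomb {p} {q} x y refl refl = cong₂ _+_ (pos-* p x) (pos-* q y)

  +C-suc : ∀ k → + C (ℕ.suc k) ≡ (+ 4 * + k + + 3) * (+ 2 * + k + + 3) * + C k + (+ 8 * + k + + 10) * + D k
  +C-suc k = pos-lincomb (C k) (D k) (pos-affine² 4 3 2 3 k) (pos-affine 8 10 k)

  +D-suc : ∀ k → + D (ℕ.suc k) ≡ (+ 4 * + k + + 3) * (+ 2 * + k + + 3) * + C k + (+ 4 * + k + + 5) * (+ 2 * + k + + 4) * + D k
  +D-suc k = pos-lincomb (C k) (D k) (pos-affine² 4 3 2 3 k) (pos-affine² 4 5 2 4 k)

  +A-suc : ∀ k → + A (ℕ.suc k) ≡ + 2 * + D k + (+ 4 * + k + + 3) * + C k
  +A-suc k = pos-lincomb {2} (D k) (C k) refl (pos-affine 4 3 k)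

  +B-suc : ∀ k → + B (ℕ.suc k) ≡ (+ 4 * + k + + 3) * + C k + (+ 8 * + k + + 10) * + D k
  +B-suc k = pos-lincomb (C k) (D k) (pos-affine 4 3 k) (pos-affine 8 10 k)

  +A-odd : ∀ k → Oddℤ (+ A k)
  +A-odd k = +-odd (A-odd k)

  +C-odd : ∀ k → Oddℤ (+ C k)
  +C-odd k = +-odd (proj₁ (C-D-odd k))

  +D-odd : ∀ k → Oddℤ (+ D k)
  +D-odd k = +-odd (proj₂ (C-D-odd k))

  C-shift-base : ∀ {k c} d → Oddℤ c →
    (+ 4 * k + + 3) * (+ 2 * k + + 3) * c + (+ 8 * k + + 10) * d
      ≡ (+ 2 * d + (+ 4 * k + + 3) * c) * + 1 + + 2 * (+ 1 + k) * + 1 mod + 4 * (+ 1 + k)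
  C-shift-base {k} d (c , refl) = witness (+ 2 * k + + 1 + (+ 4 * k + + 3) * c + + 2 * d) (solve (k ∷ c ∷ d ∷ []))

  D-shift-base : ∀ {k c d} → Oddℤ c → Oddℤ d →
    (+ 4 * k + + 3) * (+ 2 * k + + 3) * c + (+ 4 * k + + 5) * (+ 2 * k + + 4) * d
      ≡ (+ 2 * d + (+ 4 * k + + 3) * c) * + 1 + + 2 * (+ 1 + k) * + 0 mod + 4 * (+ 1 + k)
  D-shift-base {k} (c , refl) (d , refl) =
    witness (+ 4 * k + + 6 + (+ 4 * k + + 3) * c + (+ 4 * k + + 9) * d) (solve (k ∷ c ∷ d ∷ []))

  B-shift-base : ∀ k c d →
    (+ 4 * k + + 3) * c + (+ 8 * k + + 10) * d
      ≡ (+ 2 * d + (+ 4 * k + + 3) * c) * + 1 + + 2 * (+ 1 + k) * + 0 mod + 4 * (+ 1 + k)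
  B-shift-base k c d = witness (+ 2 * d) (solve (k ∷ c ∷ d ∷ []))

  -- Shifting k by κ adds 2κ (8k + 4κ + 9) to the coefficient of c′ and 8κ to that of d′;
  -- since c′ is odd (v and c are), the first contributes exactly 2κ modulo 4κ.
  C-shift-step : ∀ k κ v c d {c′ d′} → Oddℤ v → Oddℤ c →
    c′ ≡ v * c + + 2 * κ * (+ 1 + k) mod + 4 * κ →
    d′ ≡ v * d + + 2 * κ * k mod + 4 * κ →
    (+ 4 * (k + κ) + + 3) * (+ 2 * (k + κ) + + 3) * c′ + (+ 8 * (k + κ) + + 10) * d′
      ≡ v * ((+ 4 * k + + 3) * (+ 2 * k + + 3) * c + (+ 8 * k + + 10) * d) + + 2 * κ * (+ 2 + k) mod + 4 * κ
  C-shift-step k κ _ _ d (v₀ , refl) (c₀ , refl) (witness x refl) (witness y refl) =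
    witness
      ((+ 4 * k + + 3) * (+ 2 * k + + 3) * x + (+ 8 * k + + 10) * y
        + + 2 * ((+ 1 + v₀ * + 2) * d + + 2 * κ * k + y * (+ 4 * κ))
        + + 4 * k * k * k + + 17 * k * k + + 22 * k + + 8 + + 2 * κ
        + (+ 8 * k + + 4 * κ + + 9) * (v₀ + c₀ + + 2 * v₀ * c₀ + κ * (+ 1 + k) + + 2 * κ * x))
      (solve (k ∷ κ ∷ d ∷ v₀ ∷ c₀ ∷ x ∷ y ∷ []))

  D-shift-step : ∀ k κ v c d {c′ d′} → Oddℤ v → Oddℤ c → Oddℤ d →
    c′ ≡ v * c + + 2 * κ * (+ 1 + k) mod + 4 * κ →
    d′ ≡ v * d + + 2 * κ * k mod + 4 * κ →
    (+ 4 * (k + κ) + + 3) * (+ 2 * (k + κ) + + 3) * c′ + (+ 4 * (k + κ) + + 5) * (+ 2 * (k + κ) + + 4) * d′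
      ≡ v * ((+ 4 * k + + 3) * (+ 2 * k + + 3) * c + (+ 4 * k + + 5) * (+ 2 * k + + 4) * d) + + 2 * κ * (+ 1 + k) mod + 4 * κ
  D-shift-step k κ _ _ _ (v₀ , refl) (c₀ , refl) (d₀ , refl) (witness x refl) (witness y refl) =
    witness
      ((+ 4 * k + + 3) * (+ 2 * k + + 3) * x + (+ 4 * k + + 5) * (+ 2 * k + + 4) * y
        + + 8 * k * k * k + + 26 * k * k + + 31 * k + + 15 + + 4 * κ
        + (+ 8 * k + + 4 * κ + + 9) * (v₀ + c₀ + + 2 * v₀ * c₀ + κ * (+ 1 + k) + + 2 * κ * x)
        + (+ 8 * k + + 4 * κ + + 13) * (v₀ + d₀ + + 2 * v₀ * d₀ + κ * k + + 2 * κ * y))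
      (solve (k ∷ κ ∷ v₀ ∷ c₀ ∷ d₀ ∷ x ∷ y ∷ []))

  A-shift-step : ∀ k κ v c d {c′ d′} →
    c′ ≡ v * c + + 2 * κ * (+ 1 + k) mod + 4 * κ →
    d′ ≡ v * d + + 2 * κ * k mod + 4 * κ →
    + 2 * d′ + (+ 4 * (k + κ) + + 3) * c′
      ≡ v * (+ 2 * d + (+ 4 * k + + 3) * c) + + 2 * κ * (+ 1 + k) mod + 4 * κ
  A-shift-step k κ v c d (witness x refl) (witness y refl) =
    witness
      (k + + 2 * y + (+ 1 + k) * (+ 2 * k + + 1) + (+ 4 * k + + 3) * x
        + (v * c + + 2 * κ * (+ 1 + k) + x * (+ 4 * κ)))
      (solve (k ∷ κ ∷ v ∷ c ∷ d ∷ x ∷ y ∷ []))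

  B-shift-step : ∀ k κ v c d {c′ d′} →
    c′ ≡ v * c + + 2 * κ * (+ 1 + k) mod + 4 * κ →
    d′ ≡ v * d + + 2 * κ * k mod + 4 * κ →
    (+ 4 * (k + κ) + + 3) * c′ + (+ 8 * (k + κ) + + 10) * d′
      ≡ v * ((+ 4 * k + + 3) * c + (+ 8 * k + + 10) * d) + + 2 * κ * (+ 1 + k) mod + 4 * κ
  B-shift-step k κ v c d (witness x refl) (witness y refl) =
    witness
      ((+ 1 + k) * (+ 2 * k + + 1) + (+ 4 * k + + 3) * x + k * (+ 4 * k + + 5) + (+ 8 * k + + 10) * y
        + (v * c + + 2 * κ * (+ 1 + k) + x * (+ 4 * κ))
        + + 2 * (v * d + + 2 * κ * k + y * (+ 4 * κ)))
      (solve (k ∷ κ ∷ v ∷ c ∷ d ∷ x ∷ y ∷ []))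

module Periodicity where
  open import Data.Nat as ℕ using (ℕ; zero; suc; z≤n; s≤s; NonZero)
  import Data.Nat.Properties as ℕ
  open import Data.Nat.DivMod using (_%_; _/_; m≡m%n+[m/n]*n; m%n<n)
  open import Data.Nat.Tactic.RingSolver using (solve-∀)
  open import Data.Integer using (ℤ; +_; _+_; _*_)
  open import Data.Integer.Properties using (pos-*; *-identityˡ; *-assoc)
  import Data.Integer.Tactic.RingSolver as ℤ-Solver
  open OddPart
  open Blocks
  open Congruence
  open Recurrence

  module Shift (K′ : ℕ) where
    K : ℕ
    K = suc K′

    κ v : ℤ
    κ = + K
    v = + A K

    -- The defect 2κ (c + k) vanishes modulo 2κ, but modulo 4κ it is what the induction
    -- needs, and at k = K it yields A (2K) ≡ (A K)² (mod 4K).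
    Shifted : ℕ → (ℕ → ℕ) → ℕ → Set
    Shifted c V k = + V (k ℕ.+ K) ≡ v * + V k + + 2 * κ * + (c ℕ.+ k) mod + 4 * κ

    shifted-base : ∀ (c : ℕ) (V : ℕ → ℕ) {x} → + V K ≡ x →
      x ≡ (+ 2 * + D K′ + (+ 4 * + K′ + + 3) * + C K′) * + 1 + + 2 * κ * + c mod + 4 * κ →
      + V K ≡ v * + 1 + + 2 * κ * + c mod + 4 * κ
    shifted-base c V V≡x = ≡mod-resp (sym V≡x) (cong (λ a → a * + 1 + + 2 * κ * + c) (sym (+A-suc K′)))

    shifted-suc : ∀ (c : ℕ) (V : ℕ → ℕ) k {x y} → + V (suc (k ℕ.+ K)) ≡ x → + V (suc k) ≡ y →
      x ≡ v * y + + 2 * κ * + (c ℕ.+ suc k) mod + 4 * κ → Shifted c V (suc k)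
    shifted-suc c V k V≡x V≡y =
      ≡mod-resp (sym V≡x) (cong (λ a → v * a + + 2 * κ * + (c ℕ.+ suc k)) (sym V≡y))

    C-D-shifted : ∀ k → Shifted 1 C k × Shifted 0 D k
    C-D-shifted zero =
        shifted-base 1 C (+C-suc K′) (C-shift-base {+ K′} (+ D K′) (+C-odd K′))
      , shifted-base 0 D (+D-suc K′) (D-shift-base {+ K′} (+C-odd K′) (+D-odd K′))
    C-D-shifted (suc k) =
        shifted-suc 1 C k (+C-suc (k ℕ.+ K)) (+C-suc k)
          (C-shift-step (+ k) κ v (+ C k) (+ D k) (+A-odd K) (+C-odd k) C-shifted D-shifted)
      , shifted-suc 0 D k (+D-suc (k ℕ.+ K)) (+D-suc k)
          (D-shift-step (+ k) κ v (+ C k) (+ D k) (+A-odd K) (+C-odd k) (+D-odd k) C-shifted D-shifted)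
      where
      C-shifted = proj₁ (C-D-shifted k)
      D-shifted = proj₂ (C-D-shifted k)

    A-shifted : ∀ k → Shifted 0 A k
    A-shifted zero = witness (+ 0) (no-defect v κ)
      where
      no-defect : ∀ v κ → v ≡ v * + 1 + + 2 * κ * + 0 + + 0 * (+ 4 * κ)
      no-defect = ℤ-Solver.solve-∀
    A-shifted (suc k) = shifted-suc 0 A k (+A-suc (k ℕ.+ K)) (+A-suc k)
      (A-shift-step (+ k) κ v (+ C k) (+ D k) (proj₁ (C-D-shifted k)) (proj₂ (C-D-shifted k)))

    B-shifted : ∀ k → Shifted 0 B k
    B-shifted zero = shifted-base 0 B (+B-suc K′) (B-shift-base (+ K′) (+ C K′) (+ D K′))
    B-shifted (suc k) = shifted-suc 0 B k (+B-suc (k ℕ.+ K)) (+B-suc k)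
      (B-shift-step (+ k) κ v (+ C k) (+ D k) (proj₁ (C-D-shifted k)) (proj₂ (C-D-shifted k)))

    block-periodic : v ≡ + 1 mod + 2 * κ → (j c : ℕ) (V e : ℕ → ℕ) →
      (∀ k → t (j ℕ.+ k ℕ.* 4) ≡ 2 ℕ.^ e k ℕ.* V k) → (∀ k → Odd (V k)) →
      (∀ k → Shifted c V k) →
      ∀ k → + β (j ℕ.+ (k ℕ.+ K) ℕ.* 4) ≡ + β (j ℕ.+ k ℕ.* 4) mod + 2 * κ
    block-periodic v≡1 j c V e t≡ V-odd V-shifted k =
      ≡mod-resp (β≡V (k ℕ.+ K)) (β≡V k) (≡mod-trans V[k+K]≡vV V≡vV)
      where
      β≡V : ∀ k → + V k ≡ + β (j ℕ.+ k ℕ.* 4)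
      β≡V k = cong +_ (sym (β≡odd-factor {j ℕ.+ k ℕ.* 4} (e k) (t≡ k) (V-odd k)))
      V[k+K]≡vV : + V (k ℕ.+ K) ≡ v * + V k mod + 2 * κ
      V[k+K]≡vV = ≡mod-weaken {κ = κ} (+ (c ℕ.+ k)) (V-shifted k)
      V≡vV : v * + V k ≡ + V k mod + 2 * κ
      V≡vV = ≡mod-resp refl (*-identityˡ (+ V k)) (≡mod-*ʳ (+ V k) v≡1)

  A-double : ∀ h .{{_ : NonZero h}} → + A (2 ℕ.* h) ≡ + 1 mod + 2 * + (2 ℕ.* h) →
    + A (2 ℕ.* (2 ℕ.* h)) ≡ + 1 mod + 2 * + (2 ℕ.* (2 ℕ.* h))
  A-double h@(suc _) v≡1 = subst (λ m → + A (2 ℕ.* K) ≡ + 1 mod m) (sym 4κ≡)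
    (≡mod-resp (cong (λ m → + A (K ℕ.+ m)) (sym (ℕ.+-identityʳ K))) refl A[K+K]≡1)
    where
    -- h ≥ 1, so suc (pred (2 * h)) reduces to 2 * h and K below is 2 * h.
    open Shift (ℕ.pred (2 ℕ.* h))
    A[K+K]≡v*v : + A (K ℕ.+ K) ≡ v * v + + 2 * κ * (+ 2 * + h) mod + 4 * κ
    A[K+K]≡v*v = ≡mod-resp refl (cong (λ m → v * v + + 2 * κ * m) (pos-* 2 h)) (A-shifted K)
    A[K+K]≡1 : + A (K ℕ.+ K) ≡ + 1 mod + 4 * κ
    A[K+K]≡1 = ≡mod-trans (≡mod-absorb-even {κ = κ} (+ h) A[K+K]≡v*v) (square-≡1 {κ = κ} v≡1)
    4κ≡ : + 2 * + (2 ℕ.* K) ≡ + 4 * κ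
    4κ≡ = trans (cong (+ 2 *_) (pos-* 2 K)) (sym (*-assoc (+ 2) (+ 2) κ))

  A[2^r]≡1 : ∀ r → 2 ℕ.≤ r → + A (2 ℕ.^ r) ≡ + 1 mod + 2 * + (2 ℕ.^ r)
  A[2^r]≡1 (suc zero) (s≤s ())
  -- A 4 = t 16 / 2 ^ 4 = 2887921 = 1 + 360990 * 8.
  A[2^r]≡1 (suc (suc zero)) _ = witness (+ 360990) refl
  A[2^r]≡1 (suc (suc (suc r))) _ =
    A-double (2 ℕ.^ suc r) {{ℕ.m^n≢0 2 (suc r)}} (A[2^r]≡1 (suc (suc r)) (s≤s (s≤s z≤n)))

  β-periodic : ∀ K .{{_ : NonZero K}} → + A K ≡ + 1 mod + 2 * + K →
    ∀ n → + β (n ℕ.+ K ℕ.* 4) ≡ + β n mod + 2 * + K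
  β-periodic (suc K′) v≡1 n =
    ≡mod-resp (cong (λ m → + β m) n+4K≡) (cong (λ m → + β m) (sym n≡))
      (by-residue (n % 4) (m%n<n n 4) (n / 4))
    where
    open Shift K′
    open Factorisation
    by-residue : ∀ j → j ℕ.< 4 → ∀ k → + β (j ℕ.+ (k ℕ.+ K) ℕ.* 4) ≡ + β (j ℕ.+ k ℕ.* 4) mod + 2 * κ
    by-residue 0 _ = block-periodic v≡1 0 0 A (λ k → k) (t[4k] ∘ t-factorisation) A-odd A-shifted
    by-residue 1 _ = block-periodic v≡1 1 0 B (λ k → k) (t[4k+1] ∘ t-factorisation) B-odd B-shifted
    by-residue 2 _ = block-periodic v≡1 2 1 C suc (t[4k+2] ∘ t-factorisation)
      (proj₁ ∘ C-D-odd) (proj₁ ∘ C-D-shifted)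
    by-residue 3 _ = block-periodic v≡1 3 0 D (2 ℕ.+_) (t[4k+3] ∘ t-factorisation)
      (proj₂ ∘ C-D-odd) (proj₂ ∘ C-D-shifted)
    by-residue (suc (suc (suc (suc _)))) (s≤s (s≤s (s≤s (s≤s ()))))
    n≡ : n ≡ n % 4 ℕ.+ n / 4 ℕ.* 4
    n≡ = m≡m%n+[m/n]*n n 4
    n+4K≡ : n % 4 ℕ.+ (n / 4 ℕ.+ K) ℕ.* 4 ≡ n ℕ.+ K ℕ.* 4
    n+4K≡ = trans (regroup (n % 4) (n / 4) K) (cong (ℕ._+ K ℕ.* 4) (sym n≡))
      where
      regroup : ∀ r q K → r ℕ.+ (q ℕ.+ K) ℕ.* 4 ≡ r ℕ.+ q ℕ.* 4 ℕ.+ K ℕ.* 4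
      regroup = solve-∀

open Periodicity
open Congruence using (≡mod⇒∣; _≡_mod_)
open import Data.Nat using (ℕ; _+_; _^_; _≤_)
open import Data.Integer using (+_; _-_)
open import Data.Integer.Divisibility using (_∣_)
open import Data.Nat using (suc; s≤s; _*_)
open import Data.Nat.Properties using (m^n≢0; +-comm)
open import Data.Nat.Tactic.RingSolver using (solve-∀)
open import Data.Integer.Properties using (pos-*)

lemma6p5 : (s : ℕ) → 3 ≤ s → (n : ℕ) →
    (+ (2 ^ s)) ∣ (+ β (n + 2 ^ (s + 1)) - + β n)
lemma6p5 (suc r) (s≤s 2≤r) n =
  ≡mod⇒∣ (subst₂ (λ N m → + β (n + N) ≡ + β n mod m) (sym 2^[s+1]≡2^r*4) (sym (pos-* 2 (2 ^ r)))
    (β-periodic (2 ^ r) {{m^n≢0 2 r}} (A[2^r]≡1 r 2≤r) n))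
  where
  2^[s+1]≡2^r*4 : 2 ^ (suc r + 1) ≡ 2 ^ r * 4
  2^[s+1]≡2^r*4 = trans (cong (2 ^_) (+-comm (suc r) 1)) (quadruple (2 ^ r))
    where
    quadruple : ∀ p → 2 * (2 * p) ≡ p * 4
    quadruple = solve-∀
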